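{- Suppose that $A$ is a strongly computable finite factorization domain. Then the divisibility relation on $A[x]$ is computable, i.e., given $f(x),g(x) \in A[x]$, one can computably determine whether $f(x) \mid g(x)$ in $A[x]$.
   Context: A computable ring is a ring whose underlying set is a computable set $A \subseteq \mathbb{N}$ with addition and multiplication computable functions $A\times A \to A$. A strongly computable finite factorization domain (SCFFD) is a computable integral domain $A$ equipped with a computable function $D$ such that for every nonzero $a \in A$, $D(a)$ is a canonical index for the finite set of all divisors of $a$ in $A$. $A[x]$ is coded computably in the standard way. -}

module Defs where

open import Level using (_⊔_)
open import Algebra.Bundles using (CommutativeRing)
open import Data.List using (List; []; _∷_; map)
open import Data.List.Relation.Unary.Any using (Any)
open import Data.Product using (Σ; ∃; _×_)
open import Data.Sum using (_⊎_)
open import Data.Unit.Polymorphic using (⊤)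
open import Function.Bundles using (_⇔_)
open import Relation.Nullary using (¬_)
open import Relation.Binary.Definitions using (Decidable)

module _ {c ℓ} (R : CommutativeRing c ℓ) where
  open CommutativeRing R

  _∣A_ : Carrier → Carrier → Set (c ⊔ ℓ)
  a ∣A b = ∃ λ q → (a * q) ≈ b

  IsIntegralDomain : Set (c ⊔ ℓ)
  IsIntegralDomain = (¬ (1# ≈ 0#)) × (∀ a b → (a * b) ≈ 0# → (a ≈ 0#) ⊎ (b ≈ 0#))

  -- equality of the computable ring is decidable (carrier is a computable subset of ℕ)
  HasDecidableEquality : Set (c ⊔ ℓ)
  HasDecidableEquality = Decidable _≈_

  _∈A_ : Carrier → List Carrier → Set (c ⊔ ℓ)
  x ∈A xs = Any (x ≈_) xs

  -- strong computability: a (computable, i.e. Agda-definable) function D giving,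
  -- for every nonzero a, a finite list containing exactly the divisors of a
  DivisorFunction : Set (c ⊔ ℓ)
  DivisorFunction = (a : Carrier) → ¬ (a ≈ 0#) →
    Σ (List Carrier) λ ds → ∀ x → (x ∣A a) ⇔ (x ∈A ds)

  -- A[x]: polynomials as coefficient lists, lowest degree first
  Poly : Set c
  Poly = List Carrier

  _+P_ : Poly → Poly → Poly
  [] +P q = q
  (a ∷ p) +P [] = a ∷ p
  (a ∷ p) +P (b ∷ q) = (a + b) ∷ (p +P q)

  scaleP : Carrier → Poly → Poly
  scaleP a p = map (a *_) p

  _*P_ : Poly → Poly → Poly
  [] *P q = []
  (a ∷ p) *P q = scaleP a q +P (0# ∷ (p *P q))

  _≈P_ : Poly → Poly → Set ℓ
  [] ≈P [] = ⊤
  [] ≈P (b ∷ q) = (0# ≈ b) × ([] ≈P q)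
  (a ∷ p) ≈P [] = (a ≈ 0#) × (p ≈P [])
  (a ∷ p) ≈P (b ∷ q) = (a ≈ b) × (p ≈P q)

  _∣P_ : Poly → Poly → Set (c ⊔ ℓ)
  f ∣P g = ∃ λ h → (f *P h) ≈P g

module Submission where

-- Idea: compare polynomials coefficientwise and divide "from the bottom".
-- Zero constant terms of f are stripped (x·p ∣ g iff g₀ = 0 and p ∣ g/x),
-- and f = [] divides exactly the zero polynomial.  If f has a nonzero constant
-- term F₀, a quotient h of g is forced coefficient by coefficient: F₀·h₀ = g₀
-- determines h₀ (A is a domain, so F₀ cancels), and h/x must be a quotient of
-- the remainder (g − h₀·f)/x.  Whether F₀ divides an element of A is decidable,
-- since the divisor function D lists all divisors of a nonzero element.
-- Finally, in a domain deg h ≤ deg g, so it suffices to search for quotients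
-- whose coefficients vanish from index (length g) on; this bounded search is a
-- terminating recursion.

open import Defs
open import Level using (_⊔_)
open import Algebra.Bundles using (CommutativeRing)
import Algebra.Properties.CommutativeSemigroup as CommutativeSemigroupProperties
import Algebra.Properties.Group as GroupProperties
import Algebra.Properties.Ring as RingProperties
import Relation.Binary.Reasoning.Setoid as SetoidReasoning
open import Data.Nat as ℕ using (ℕ; zero; suc; _≤_; _<_; z≤n; s≤s)
open import Data.Nat.Properties using (m≤n+m; ≤-<-trans; <-≤-trans)
open import Data.List using ([]; _∷_; length)
open import Data.List.Relation.Unary.Any using (any?)
open import Data.Product using (∃; _×_; _,_; proj₁; proj₂)
open import Data.Sum using (_⊎_; inj₁; inj₂)
open import Data.Empty using (⊥-elim)
open import Data.Unit.Polymorphic using (tt)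
open import Function.Bundles using (_⇔_; mk⇔; Equivalence)
open import Relation.Nullary using (Dec; yes; no; ¬_)
open import Relation.Nullary.Decidable using (map; map′; _×-dec_)

module Polynomials {c ℓ} (R : CommutativeRing c ℓ) where
  open CommutativeRing R
  open SetoidReasoning setoid
  open CommutativeSemigroupProperties +-commutativeSemigroup using (x∙yz≈y∙xz)
  open GroupProperties +-group using (y≈x\\z; \\-leftDividesˡ; x≈y⇒x∙y⁻¹≈ε; x∙y⁻¹≈ε⇒x≈y)
  open RingProperties ring using (-‿distribˡ-*; x[y-z]≈xy-xz)

  infixl 6 _⊕_
  infixl 7 _⊛_
  infix 4 _≋_ _∣≋_

  _⊕_ : Poly R → Poly R → Poly R
  _⊕_ = _+P_ R

  _⊛_ : Poly R → Poly R → Poly R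
  _⊛_ = _*P_ R

  coeff : Poly R → ℕ → Carrier
  coeff []      n       = 0#
  coeff (a ∷ p) zero    = a
  coeff (a ∷ p) (suc n) = coeff p n

  tail : Poly R → Poly R
  tail []      = []
  tail (_ ∷ p) = p

  coeff-tail : ∀ g k → coeff (tail g) k ≈ coeff g (suc k)
  coeff-tail []      k = refl
  coeff-tail (b ∷ g) k = refl

  _≋_ : Poly R → Poly R → Set ℓ
  p ≋ q = ∀ n → coeff p n ≈ coeff q n

  IsZero : Poly R → Set ℓ
  IsZero p = ∀ n → coeff p n ≈ 0#

  VanishesFrom : Poly R → ℕ → Set ℓ
  VanishesFrom h n = ∀ j → n ≤ j → coeff h j ≈ 0#

  HasDegree : Poly R → ℕ → Set ℓ
  HasDegree p d = ¬ coeff p d ≈ 0# × VanishesFrom p (suc d)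

  ≈P⇒≋ : ∀ p q → _≈P_ R p q → p ≋ q
  ≈P⇒≋ []      []      _       n       = refl
  ≈P⇒≋ []      (b ∷ q) (e , _) zero    = e
  ≈P⇒≋ []      (b ∷ q) (_ , r) (suc n) = ≈P⇒≋ [] q r n
  ≈P⇒≋ (a ∷ p) []      (e , _) zero    = e
  ≈P⇒≋ (a ∷ p) []      (_ , r) (suc n) = ≈P⇒≋ p [] r n
  ≈P⇒≋ (a ∷ p) (b ∷ q) (e , _) zero    = e
  ≈P⇒≋ (a ∷ p) (b ∷ q) (_ , r) (suc n) = ≈P⇒≋ p q r n

  ≋⇒≈P : ∀ p q → p ≋ q → _≈P_ R p q
  ≋⇒≈P []      []      _ = tt
  ≋⇒≈P []      (b ∷ q) e = e 0 , ≋⇒≈P [] q (λ n → e (suc n))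
  ≋⇒≈P (a ∷ p) []      e = e 0 , ≋⇒≈P p [] (λ n → e (suc n))
  ≋⇒≈P (a ∷ p) (b ∷ q) e = e 0 , ≋⇒≈P p q (λ n → e (suc n))

  _∣≋_ : Poly R → Poly R → Set (c ⊔ ℓ)
  f ∣≋ g = ∃ λ h → f ⊛ h ≋ g

  ∣≋⇔∣P : ∀ f g → f ∣≋ g ⇔ _∣P_ R f g
  ∣≋⇔∣P f g = mk⇔ (λ (h , e) → h , ≋⇒≈P _ g e) (λ (h , e) → h , ≈P⇒≋ _ g e)

  coeff-⊕ : ∀ p q n → coeff (p ⊕ q) n ≈ coeff p n + coeff q n
  coeff-⊕ []      q       n       = sym (+-identityˡ _)
  coeff-⊕ (a ∷ p) []      n       = sym (+-identityʳ _)
  coeff-⊕ (a ∷ p) (b ∷ q) zero    = refl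
  coeff-⊕ (a ∷ p) (b ∷ q) (suc n) = coeff-⊕ p q n

  coeff-scale : ∀ a p n → coeff (scaleP R a p) n ≈ a * coeff p n
  coeff-scale a []      n       = sym (zeroʳ a)
  coeff-scale a (b ∷ p) zero    = refl
  coeff-scale a (b ∷ p) (suc n) = coeff-scale a p n

  coeff-⊛-cons-zero : ∀ a p h → coeff ((a ∷ p) ⊛ h) 0 ≈ a * coeff h 0
  coeff-⊛-cons-zero a p h = begin
    coeff (scaleP R a h ⊕ (0# ∷ p ⊛ h)) 0  ≈⟨ coeff-⊕ (scaleP R a h) _ 0 ⟩
    coeff (scaleP R a h) 0 + 0#            ≈⟨ +-identityʳ _ ⟩
    coeff (scaleP R a h) 0                 ≈⟨ coeff-scale a h 0 ⟩
    a * coeff h 0                          ∎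

  coeff-⊛-cons-suc : ∀ a p h n →
    coeff ((a ∷ p) ⊛ h) (suc n) ≈ a * coeff h (suc n) + coeff (p ⊛ h) n
  coeff-⊛-cons-suc a p h n =
    trans (coeff-⊕ (scaleP R a h) _ (suc n)) (+-cong (coeff-scale a h (suc n)) refl)

  ⊛-zeroˡ : ∀ f h → IsZero f → IsZero (f ⊛ h)
  ⊛-zeroˡ []      h z n       = refl
  ⊛-zeroˡ (a ∷ p) h z zero    =
    trans (coeff-⊛-cons-zero a p h) (trans (*-cong (z 0) refl) (zeroˡ _))
  ⊛-zeroˡ (a ∷ p) h z (suc n) = trans (coeff-⊛-cons-suc a p h n)
    (trans (+-cong (trans (*-cong (z 0) refl) (zeroˡ _)) (⊛-zeroˡ p h (λ k → z (suc k)) n))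
           (+-identityˡ 0#))

  ⊛-zeroʳ : ∀ f h → IsZero h → IsZero (f ⊛ h)
  ⊛-zeroʳ []      h z n       = refl
  ⊛-zeroʳ (a ∷ p) h z zero    =
    trans (coeff-⊛-cons-zero a p h) (trans (*-cong refl (z 0)) (zeroʳ _))
  ⊛-zeroʳ (a ∷ p) h z (suc n) = trans (coeff-⊛-cons-suc a p h n)
    (trans (+-cong (trans (*-cong refl (z (suc n))) (zeroʳ _)) (⊛-zeroʳ p h z n))
           (+-identityˡ 0#))

  coeff-⊛-zero : ∀ f h → coeff (f ⊛ h) 0 ≈ coeff f 0 * coeff h 0
  coeff-⊛-zero []      h = sym (zeroˡ _)
  coeff-⊛-zero (a ∷ p) h = coeff-⊛-cons-zero a p h

  -- Splitting off the constant term of the right factor: f·h = h₀·f + x·f·(h/x).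
  -- This is the step of long division from the bottom.
  coeff-⊛-suc : ∀ f h k →
    coeff (f ⊛ h) (suc k) ≈ coeff h 0 * coeff f (suc k) + coeff (f ⊛ tail h) k
  coeff-⊛-suc f [] k = begin
    coeff (f ⊛ []) (suc k)               ≈⟨ ⊛-zeroʳ f [] (λ _ → refl) (suc k) ⟩
    0#                                   ≈⟨ +-identityˡ 0# ⟨
    0# + 0#                              ≈⟨ +-cong (zeroˡ _) (⊛-zeroʳ f [] (λ _ → refl) k) ⟨
    0# * coeff f (suc k) + coeff (f ⊛ []) k ∎
  coeff-⊛-suc [] (b ∷ h) k = sym (trans (+-cong (zeroʳ b) refl) (+-identityˡ _))
  coeff-⊛-suc (a ∷ p) (b ∷ h) zero = begin
    coeff ((a ∷ p) ⊛ (b ∷ h)) 1          ≈⟨ coeff-⊛-cons-suc a p (b ∷ h) 0 ⟩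
    a * coeff h 0 + coeff (p ⊛ (b ∷ h)) 0 ≈⟨ +-cong refl (coeff-⊛-zero p (b ∷ h)) ⟩
    a * coeff h 0 + coeff p 0 * b        ≈⟨ +-comm _ _ ⟩
    coeff p 0 * b + a * coeff h 0        ≈⟨ +-cong (*-comm _ _) (coeff-⊛-cons-zero a p h) ⟨
    b * coeff p 0 + coeff ((a ∷ p) ⊛ h) 0 ∎
  coeff-⊛-suc (a ∷ p) (b ∷ h) (suc k) = begin
    coeff ((a ∷ p) ⊛ (b ∷ h)) (suc (suc k))
      ≈⟨ coeff-⊛-cons-suc a p (b ∷ h) (suc k) ⟩
    a * coeff h (suc k) + coeff (p ⊛ (b ∷ h)) (suc k)
      ≈⟨ +-cong refl (coeff-⊛-suc p (b ∷ h) k) ⟩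
    a * coeff h (suc k) + (b * coeff p (suc k) + coeff (p ⊛ h) k)
      ≈⟨ x∙yz≈y∙xz _ _ _ ⟩
    b * coeff p (suc k) + (a * coeff h (suc k) + coeff (p ⊛ h) k)
      ≈⟨ +-cong refl (coeff-⊛-cons-suc a p h k) ⟨
    b * coeff p (suc k) + coeff ((a ∷ p) ⊛ h) (suc k)
      ∎

  coeff-⊛-top : ∀ f h d m → VanishesFrom f (suc d) → VanishesFrom h (suc m) →
    coeff (f ⊛ h) (d ℕ.+ m) ≈ coeff f d * coeff h m
  coeff-⊛-top []      h d       m       fv hv = sym (zeroˡ _)
  coeff-⊛-top (a ∷ p) h zero    zero    fv hv = coeff-⊛-cons-zero a p h
  coeff-⊛-top (a ∷ p) h zero    (suc m) fv hv = trans (coeff-⊛-cons-suc a p h m)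
    (trans (+-cong refl (⊛-zeroˡ p h (λ j → fv (suc j) (s≤s z≤n)) m)) (+-identityʳ _))
  coeff-⊛-top (a ∷ p) h (suc d) m       fv hv = trans (coeff-⊛-cons-suc a p h (d ℕ.+ m))
    (trans (+-cong (trans (*-cong refl (hv _ (s≤s (m≤n+m m d)))) (zeroʳ a))
                   (coeff-⊛-top p h d m (λ j d<j → fv (suc j) (s≤s d<j)) hv))
           (+-identityˡ _))

  nonzero⇒<length : ∀ g n → ¬ coeff g n ≈ 0# → n < length g
  nonzero⇒<length []      n       g≉0 = ⊥-elim (g≉0 refl)
  nonzero⇒<length (b ∷ g) zero    _   = s≤s z≤n
  nonzero⇒<length (b ∷ g) (suc n) g≉0 = s≤s (nonzero⇒<length g n g≉0)

  -- Zero constant term of the divisor: (0 + x·p)·h = x·(p·h), so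
  -- x·p divides g exactly when g₀ = 0 and p divides g/x.
  zero-cons-⊛ : ∀ {a} p h → a ≈ 0# → (a ∷ p) ⊛ h ≋ 0# ∷ (p ⊛ h)
  zero-cons-⊛ {a} p h a≈0 zero =
    trans (coeff-⊛-cons-zero a p h) (trans (*-cong a≈0 refl) (zeroˡ _))
  zero-cons-⊛ {a} p h a≈0 (suc k) = trans (coeff-⊛-cons-suc a p h k)
    (trans (+-cong (trans (*-cong a≈0 refl) (zeroˡ _)) refl) (+-identityˡ _))

  zero-cons-∣≋ : ∀ {a} p g → a ≈ 0# → (coeff g 0 ≈ 0# × p ∣≋ tail g) ⇔ (a ∷ p) ∣≋ g
  zero-cons-∣≋ p g a≈0 = mk⇔
    (λ (g₀≈0 , h , e) → h , λ
      { zero    → trans (zero-cons-⊛ p h a≈0 0) (sym g₀≈0)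
      ; (suc k) → trans (zero-cons-⊛ p h a≈0 (suc k)) (trans (e k) (coeff-tail g k)) })
    (λ (h , e) → trans (sym (e 0)) (zero-cons-⊛ p h a≈0 0)
               , h , λ k → trans (sym (zero-cons-⊛ p h a≈0 (suc k)))
                                 (trans (e (suc k)) (sym (coeff-tail g k))))

  []-∣≋ : ∀ g → IsZero g ⇔ [] ∣≋ g
  []-∣≋ g = mk⇔ (λ z → [] , λ n → sym (z n)) (λ (_ , e) n → sym (e n))

  module _ (dom : IsIntegralDomain R) where
    nonzero-factor : ∀ {a b} → ¬ a ≈ 0# → a * b ≈ 0# → b ≈ 0#
    nonzero-factor a≉0 ab≈0 with proj₂ dom _ _ ab≈0
    ... | inj₁ a≈0 = ⊥-elim (a≉0 a≈0)
    ... | inj₂ b≈0 = b≈0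

    product-nonzero : ∀ {a b} → ¬ a ≈ 0# → ¬ b ≈ 0# → ¬ a * b ≈ 0#
    product-nonzero a≉0 b≉0 ab≈0 = b≉0 (nonzero-factor a≉0 ab≈0)

    *-cancelˡ : ∀ {a} → ¬ a ≈ 0# → ∀ x y → a * x ≈ a * y → x ≈ y
    *-cancelˡ {a} a≉0 x y ax≈ay = x∙y⁻¹≈ε⇒x≈y x y (nonzero-factor a≉0 (begin
      a * (x - y)    ≈⟨ x[y-z]≈xy-xz a x y ⟩
      a * x - a * y  ≈⟨ x≈y⇒x∙y⁻¹≈ε ax≈ay ⟩
      0#             ∎))

  -- Divisibility in A is decidable: 0 is divisible by everything, and the
  -- divisors of a nonzero b are exactly the members of the finite list D b.
  divisible? : HasDecidableEquality R → DivisorFunction R → ∀ a b → Dec (_∣A_ R a b)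
  divisible? _≟_ D a b with b ≟ 0#
  ... | yes b≈0 = yes (0# , trans (zeroʳ a) (sym b≈0))
  ... | no  b≉0 = map′ (Equivalence.from divisors) (Equivalence.to divisors) (any? (a ≟_) _)
    where
      divisors : _∣A_ R a b ⇔ _∈A_ R a (proj₁ (D b b≉0))
      divisors = proj₂ (D b b≉0) a

  module _ (_≟_ : HasDecidableEquality R) where
    zero-or-degree : ∀ p → IsZero p ⊎ ∃ (HasDegree p)
    zero-or-degree []      = inj₁ (λ _ → refl)
    zero-or-degree (a ∷ p) with zero-or-degree p
    ... | inj₂ (d , p_d≉0 , pv) =
      inj₂ (suc d , p_d≉0 , λ { zero () ; (suc j) (s≤s d<j) → pv j d<j })
    ... | inj₁ p≡0 with a ≟ 0#
    ...   | yes a≈0 = inj₁ λ { zero → a≈0 ; (suc n) → p≡0 n }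
    ...   | no  a≉0 = inj₂ (0 , a≉0 , λ { zero () ; (suc j) _ → p≡0 j })

    isZero? : ∀ p → Dec (IsZero p)
    isZero? p with zero-or-degree p
    ... | inj₁ p≡0           = yes p≡0
    ... | inj₂ (d , p_d≉0 , _) = no λ p≡0 → p_d≉0 (p≡0 d)

    -- Degree bound: over a domain, a quotient of g by a nonzero f has
    -- deg h ≤ deg f + deg h = deg g < length g.
    quotient-vanishes : IsIntegralDomain R → ∀ f h g → ¬ IsZero f → f ⊛ h ≋ g →
      VanishesFrom h (length g)
    quotient-vanishes dom f h g f≢0 fh≋g with zero-or-degree f | zero-or-degree h
    ... | inj₁ f≡0 | _         = ⊥-elim (f≢0 f≡0)
    ... | inj₂ _   | inj₁ h≡0  = λ j _ → h≡0 j
    ... | inj₂ (d , f_d≉0 , fv) | inj₂ (m , h_m≉0 , hv) =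
      λ j len≤j → hv j (<-≤-trans m<length len≤j)
      where
        top≉0 : ¬ coeff g (d ℕ.+ m) ≈ 0#
        top≉0 g_top≈0 = product-nonzero dom f_d≉0 h_m≉0
          (trans (sym (coeff-⊛-top f h d m fv hv)) (trans (fh≋g _) g_top≈0))
        m<length : m < length g
        m<length = ≤-<-trans (m≤n+m m d) (nonzero⇒<length g _ top≉0)

    module BottomDivision (F : Poly R)
      (cancel : ∀ x y → coeff F 0 * x ≈ coeff F 0 * y → x ≈ y)
      (F₀-divides? : ∀ b → Dec (_∣A_ R (coeff F 0) b)) where

      -- (g − q·F)/x, what remains to be divided once the quotient starts with q.
      remainder : Carrier → Poly R → Poly R
      remainder q g = tail (scaleP R (- q) F ⊕ g)

      coeff-remainder : ∀ q g k →
        coeff (remainder q g) k ≈ - (q * coeff F (suc k)) + coeff g (suc k)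
      coeff-remainder q g k = begin
        coeff (remainder q g) k
          ≈⟨ coeff-tail (scaleP R (- q) F ⊕ g) k ⟩
        coeff (scaleP R (- q) F ⊕ g) (suc k)
          ≈⟨ coeff-⊕ (scaleP R (- q) F) g (suc k) ⟩
        coeff (scaleP R (- q) F) (suc k) + coeff g (suc k)
          ≈⟨ +-cong (coeff-scale (- q) F (suc k)) refl ⟩
        - q * coeff F (suc k) + coeff g (suc k)
          ≈⟨ +-cong (-‿distribˡ-* q _) refl ⟨
        - (q * coeff F (suc k)) + coeff g (suc k)
          ∎

      remainder-cong : ∀ {q q′} g → q ≈ q′ → remainder q g ≋ remainder q′ g
      remainder-cong {q} {q′} g q≈q′ k = begin
        coeff (remainder q g) k                     ≈⟨ coeff-remainder q g k ⟩
        - (q * coeff F (suc k)) + coeff g (suc k)   ≈⟨ +-cong (-‿cong (*-cong q≈q′ refl)) refl ⟩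
        - (q′ * coeff F (suc k)) + coeff g (suc k)  ≈⟨ coeff-remainder q′ g k ⟨
        coeff (remainder q′ g) k                    ∎

      division-step : ∀ h g →
        F ⊛ h ≋ g ⇔ (coeff F 0 * coeff h 0 ≈ coeff g 0 × F ⊛ tail h ≋ remainder (coeff h 0) g)
      division-step h g = mk⇔
        (λ e → trans (sym (coeff-⊛-zero F h)) (e 0)
             , λ k → trans (y≈x\\z _ _ _ (trans (sym (coeff-⊛-suc F h k)) (e (suc k))))
                           (sym (coeff-remainder (coeff h 0) g k)))
        (λ { (e₀ , e) zero    → trans (coeff-⊛-zero F h) e₀
           ; (e₀ , e) (suc k) → begin
               coeff (F ⊛ h) (suc k)
                 ≈⟨ coeff-⊛-suc F h k ⟩
               coeff h 0 * coeff F (suc k) + coeff (F ⊛ tail h) k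
                 ≈⟨ +-cong refl (trans (e k) (coeff-remainder (coeff h 0) g k)) ⟩
               coeff h 0 * coeff F (suc k) + (- (coeff h 0 * coeff F (suc k)) + coeff g (suc k))
                 ≈⟨ \\-leftDividesˡ _ _ ⟩
               coeff g (suc k)
                 ∎ })

      BoundedQuotient : ℕ → Poly R → Set (c ⊔ ℓ)
      BoundedQuotient n g = ∃ λ h → F ⊛ h ≋ g × VanishesFrom h n

      extend-quotient : ∀ {q} n g → coeff F 0 * q ≈ coeff g 0 →
        BoundedQuotient n (remainder q g) → BoundedQuotient (suc n) g
      extend-quotient {q} n g F₀q≈g₀ (h , e , hv) =
        q ∷ h , Equivalence.from (division-step (q ∷ h) g) (F₀q≈g₀ , e)
              , λ { zero () ; (suc j) (s≤s n≤j) → hv j n≤j }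

      shorten-quotient : ∀ {q} n g → coeff F 0 * q ≈ coeff g 0 →
        BoundedQuotient (suc n) g → BoundedQuotient n (remainder q g)
      shorten-quotient {q} n g F₀q≈g₀ (h , e , hv) =
        tail h , (λ k → trans (e′ k) (remainder-cong g h₀≈q k))
               , λ j n≤j → trans (coeff-tail h j) (hv (suc j) (s≤s n≤j))
        where
          F₀h₀≈g₀ : coeff F 0 * coeff h 0 ≈ coeff g 0
          F₀h₀≈g₀ = proj₁ (Equivalence.to (division-step h g) e)
          e′ : F ⊛ tail h ≋ remainder (coeff h 0) g
          e′ = proj₂ (Equivalence.to (division-step h g) e)
          h₀≈q : coeff h 0 ≈ q
          h₀≈q = cancel _ _ (trans F₀h₀≈g₀ (sym F₀q≈g₀))

      boundedQuotient? : ∀ n g → Dec (BoundedQuotient n g)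
      boundedQuotient? zero g with isZero? g
      ... | yes g≡0 = yes ([] , (λ k → trans (⊛-zeroʳ F [] (λ _ → refl) k) (sym (g≡0 k)))
                              , λ _ _ → refl)
      ... | no  g≢0 = no λ (h , e , hv) →
        g≢0 (λ k → trans (sym (e k)) (⊛-zeroʳ F h (λ j → hv j z≤n) k))
      boundedQuotient? (suc n) g with F₀-divides? (coeff g 0)
      ... | no  F₀∤g₀ = no λ (h , e , _) →
        F₀∤g₀ (coeff h 0 , proj₁ (Equivalence.to (division-step h g) e))
      ... | yes (q , F₀q≈g₀) =
        map′ (extend-quotient n g F₀q≈g₀) (shorten-quotient n g F₀q≈g₀)
             (boundedQuotient? n (remainder q g))

    module _ (dom : IsIntegralDomain R) (D : DivisorFunction R) where
      nonzero-constant-∣≋? : ∀ F → ¬ coeff F 0 ≈ 0# → ∀ g → Dec (F ∣≋ g)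
      nonzero-constant-∣≋? F F₀≉0 g =
        map′ (λ (h , e , _) → h , e)
             (λ (h , e) → h , e , quotient-vanishes dom F h g (λ F≡0 → F₀≉0 (F≡0 0)) e)
             (boundedQuotient? (length g) g)
        where open BottomDivision F (*-cancelˡ dom F₀≉0) (divisible? _≟_ D (coeff F 0))

      ∣≋? : ∀ f g → Dec (f ∣≋ g)
      ∣≋? []      g = map ([]-∣≋ g) (isZero? g)
      ∣≋? (a ∷ p) g with a ≟ 0#
      ... | no  a≉0 = nonzero-constant-∣≋? (a ∷ p) a≉0 g
      ... | yes a≈0 = map (zero-cons-∣≋ p g a≈0)
                          ((coeff g 0 ≟ 0#) ×-dec ∣≋? p (tail g))

mainTheorem9 : ∀ {c ℓ} (R : CommutativeRing c ℓ) →
    HasDecidableEquality R → IsIntegralDomain R → DivisorFunction R →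
    (f g : Poly R) → Dec (_∣P_ R f g)
mainTheorem9 R _≟_ dom D f g = map (∣≋⇔∣P f g) (∣≋? _≟_ dom D f g)
  where open Polynomials R
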